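{- For every finite connected graph $G$, (i) $Z_c(G) \le F_{cd}(G) \le Z_c(G) + \gamma_c(G)$, and (ii) $\gamma_c(G) \le F_{cd}(G) \le Z_c(G) + \gamma_c(G)$.
   Context: All graphs are finite, simple and connected. Color-change rule: if each vertex is colored black or white, and a black vertex $u$ has exactly one white neighbor $v$, then $v$ is recolored black ($u$ forces $v$). A zero forcing set of $G$ is a set $Z\subseteq V(G)$ such that, starting with exactly the vertices of $Z$ black, repeated application of the color-change rule eventually colors every vertex black. A connected zero forcing set is a zero forcing set $Z$ whose induced subgraph $\langle Z\rangle$ is connected; $Z_c(G)$ is the minimum size of a connected zero forcing set. A dominating set is a set $D$ such that every vertex is in $D$ or has a neighbor in $D$; a connected dominating set is a dominating set inducing a connected subgraph, and $\gamma_c(G)$ is the minimum size of a connected dominating set. A connected dom-forcing set of $G$ is a set $S\subseteq V(G)$ such that $\langle S\rangle$ is connected, $S$ is dominating, and $S$ is a zero forcing set; $F_{cd}(G)$ is the minimum size of a connected dom-forcing set. -}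

module Defs where

open import Data.Nat using (ℕ; suc; _≤_)
open import Data.Fin using (Fin)
open import Data.Fin.Subset using (Subset; _∈_; ∣_∣; ⊤)
open import Data.Bool using (Bool; T)
open import Data.Product using (Σ; _×_; ∃)
open import Data.Sum using (_⊎_)
open import Relation.Binary.PropositionalEquality using (_≡_; _≢_)
open import Relation.Nullary using (¬_)

record Graph (n : ℕ) : Set where
  field
    adj   : Fin n → Fin n → Bool
    sym   : ∀ u v → adj u v ≡ adj v u
    irrefl : ∀ v → ¬ T (adj v v)

open Graph public

Adj : ∀ {n} → Graph n → Fin n → Fin n → Set
Adj G u v = T (adj G u v)

data Walk {n} (G : Graph n) (S : Subset n) : Fin n → Fin n → Set where
  here : ∀ {v} → v ∈ S → Walk G S v v
  step : ∀ {u w v} → u ∈ S → Adj G u w → Walk G S w v → Walk G S u v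

InducedConnected : ∀ {n} → Graph n → Subset n → Set
InducedConnected G S = ∀ u v → u ∈ S → v ∈ S → Walk G S u v

Connected : ∀ {n} → Graph n → Set
Connected {n} G = InducedConnected G ⊤

Dominating : ∀ {n} → Graph n → Subset n → Set
Dominating G D = ∀ v → v ∈ D ⊎ ∃ λ u → u ∈ D × Adj G u v

-- Vertices eventually colored black when starting from Z black:
-- the closure of Z under the color-change rule (u black, v a neighbor of u,
-- and every neighbor of u other than v black ⇒ v becomes black).
data Black {n} (G : Graph n) (Z : Subset n) : Fin n → Set where
  init  : ∀ {v} → v ∈ Z → Black G Z v
  force : ∀ {u v} → Black G Z u → Adj G u v →
          (∀ w → Adj G u w → w ≢ v → Black G Z w) → Black G Z v

ZeroForcing : ∀ {n} → Graph n → Subset n → Set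
ZeroForcing G Z = ∀ v → Black G Z v

ConnectedZeroForcing : ∀ {n} → Graph n → Subset n → Set
ConnectedZeroForcing G Z = InducedConnected G Z × ZeroForcing G Z

ConnectedDominating : ∀ {n} → Graph n → Subset n → Set
ConnectedDominating G D = InducedConnected G D × Dominating G D

ConnectedDomForcing : ∀ {n} → Graph n → Subset n → Set
ConnectedDomForcing G S = InducedConnected G S × Dominating G S × ZeroForcing G S

IsMinSize : ∀ {n} → (Subset n → Set) → ℕ → Set
IsMinSize P k = (Σ _ λ S → P S × ∣ S ∣ ≡ k) × (∀ S → P S → k ≤ ∣ S ∣)

Zc≡ : ∀ {n} → Graph n → ℕ → Set
Zc≡ G k = IsMinSize (ConnectedZeroForcing G) k

γc≡ : ∀ {n} → Graph n → ℕ → Set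
γc≡ G k = IsMinSize (ConnectedDominating G) k

Fcd≡ : ∀ {n} → Graph n → ℕ → Set
Fcd≡ G k = IsMinSize (ConnectedDomForcing G) k

-- A connected dom-forcing set is both a connected zero forcing set and a connected
-- dominating set, which gives the lower bounds. For the upper bound, Z ∪ D is a connected
-- dom-forcing set whenever Z is zero forcing and D is connected dominating: forcing is
-- monotone in the initial set, supersets of dominating sets dominate, and every vertex of
-- Z ∪ D is at most one edge away from the connected set D.
module Submission where

open import Defs
open import Data.Nat using (suc; _≤_; _+_; z≤n; s≤s)
open import Data.Nat.Properties using (≤-trans; +-monoʳ-≤; n≤1+n; +-suc; ≤-reflexive; +-mono-≤)
open import Data.Product using (_×_; _,_; Σ)
open import Data.Sum using (inj₁; inj₂)
import Data.Sum as Sum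
open import Data.Bool using (true; false; T)
open import Data.Vec using ([]; _∷_)
open import Data.Fin using (Fin)
open import Data.Fin.Subset using (Subset; _∈_; _∪_; ∣_∣; _⊆_)
open import Data.Fin.Subset.Properties using (p⊆p∪q; q⊆p∪q)
open import Relation.Binary.PropositionalEquality using (_≡_; subst) renaming (sym to ≡-sym)

∣p∪q∣≤∣p∣+∣q∣ : ∀ {n} (p q : Subset n) → ∣ p ∪ q ∣ ≤ ∣ p ∣ + ∣ q ∣
∣p∪q∣≤∣p∣+∣q∣ []          []          = z≤n
∣p∪q∣≤∣p∣+∣q∣ (true ∷ p)  (true ∷ q)  = s≤s (≤-trans (∣p∪q∣≤∣p∣+∣q∣ p q) (+-monoʳ-≤ ∣ p ∣ (n≤1+n ∣ q ∣)))
∣p∪q∣≤∣p∣+∣q∣ (true ∷ p)  (false ∷ q) = s≤s (∣p∪q∣≤∣p∣+∣q∣ p q)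
∣p∪q∣≤∣p∣+∣q∣ (false ∷ p) (true ∷ q)  = ≤-trans (s≤s (∣p∪q∣≤∣p∣+∣q∣ p q)) (≤-reflexive (≡-sym (+-suc ∣ p ∣ ∣ q ∣)))
∣p∪q∣≤∣p∣+∣q∣ (false ∷ p) (false ∷ q) = ∣p∪q∣≤∣p∣+∣q∣ p q

IsMinSize-≤-size : ∀ {n} {P : Subset n → Set} {k} → IsMinSize P k → ∀ {S} → P S → k ≤ ∣ S ∣
IsMinSize-≤-size (_ , minimal) {S} = minimal S

IsMinSize-mono : ∀ {n} {P Q : Subset n → Set} → (∀ {S} → P S → Q S) →
                 ∀ {k l} → IsMinSize Q k → IsMinSize P l → k ≤ l
IsMinSize-mono P⇒Q minQ ((S , PS , ∣S∣≡l) , _) = subst (_ ≤_) ∣S∣≡l (IsMinSize-≤-size minQ (P⇒Q PS))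

module _ {n} (G : Graph n) where

  Adj-sym : ∀ {u v} → Adj G u v → Adj G v u
  Adj-sym {u} {v} = subst T (Graph.sym G u v)

  Walk-mono : ∀ {S T} → S ⊆ T → ∀ {u v} → Walk G S u v → Walk G T u v
  Walk-mono S⊆T (here v∈S)        = here (S⊆T v∈S)
  Walk-mono S⊆T (step u∈S uw walk) = step (S⊆T u∈S) uw (Walk-mono S⊆T walk)

  _++ʷ_ : ∀ {S u v w} → Walk G S u v → Walk G S v w → Walk G S u w
  here _          ++ʷ walk′ = walk′
  step u∈S uw walk ++ʷ walk′ = step u∈S uw (walk ++ʷ walk′)

  Black-mono : ∀ {Z S} → Z ⊆ S → ∀ {v} → Black G Z v → Black G S v
  Black-mono Z⊆S (init v∈Z)           = init (Z⊆S v∈Z)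
  Black-mono Z⊆S (force bu uv others) = force (Black-mono Z⊆S bu) uv (λ w uw w≢v → Black-mono Z⊆S (others w uw w≢v))

  ZeroForcing-mono : ∀ {Z S} → Z ⊆ S → ZeroForcing G Z → ZeroForcing G S
  ZeroForcing-mono Z⊆S forcing v = Black-mono Z⊆S (forcing v)

  Dominating-mono : ∀ {D S} → D ⊆ S → Dominating G D → Dominating G S
  Dominating-mono D⊆S dominating v =
    Sum.map D⊆S (λ { (u , u∈D , uv) → u , D⊆S u∈D , uv }) (dominating v)

  module _ (Z : Subset n) {D : Subset n} (dominating : Dominating G D) where

    walks-to-dominator : ∀ u → u ∈ Z ∪ D →
      Σ (Fin n) λ d → d ∈ D × Walk G (Z ∪ D) u d × Walk G (Z ∪ D) d u
    walks-to-dominator u u∈Z∪D with dominating u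
    ... | inj₁ u∈D = u , u∈D , here u∈Z∪D , here u∈Z∪D
    ... | inj₂ (d , d∈D , du) =
      d , d∈D , step u∈Z∪D (Adj-sym du) (here d∈Z∪D) , step d∈Z∪D du (here u∈Z∪D)
      where d∈Z∪D = q⊆p∪q Z D d∈D

    InducedConnected-∪-dominating : InducedConnected G D → InducedConnected G (Z ∪ D)
    InducedConnected-∪-dominating connected u v u∈Z∪D v∈Z∪D
      with walks-to-dominator u u∈Z∪D | walks-to-dominator v v∈Z∪D
    ... | d , d∈D , u→d , _ | d′ , d′∈D , _ , d′→v =
      u→d ++ʷ (Walk-mono (q⊆p∪q Z D) (connected d d′ d∈D d′∈D) ++ʷ d′→v)

  ConnectedDomForcing-∪ : ∀ {Z D} → ZeroForcing G Z → ConnectedDominating G D →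
                          ConnectedDomForcing G (Z ∪ D)
  ConnectedDomForcing-∪ {Z} {D} forcing (connected , dominating) =
      InducedConnected-∪-dominating Z dominating connected
    , Dominating-mono (q⊆p∪q Z D) dominating
    , ZeroForcing-mono (p⊆p∪q D) forcing

  Fcd≤Zc+γc : ∀ {zc fcd γc} → Zc≡ G zc → Fcd≡ G fcd → γc≡ G γc → fcd ≤ zc + γc
  Fcd≤Zc+γc ((Z , (_ , forcing) , ∣Z∣≡zc) , _) minF ((D , connDom , ∣D∣≡γc) , _) =
    ≤-trans (IsMinSize-≤-size minF (ConnectedDomForcing-∪ forcing connDom))
            (≤-trans (∣p∪q∣≤∣p∣+∣q∣ Z D) (+-mono-≤ (≤-reflexive ∣Z∣≡zc) (≤-reflexive ∣D∣≡γc)))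

mainTheorem1 : ∀ {m} (G : Graph (suc m)) → Connected G →
    ∀ zc fcd γc → Zc≡ G zc → Fcd≡ G fcd → γc≡ G γc →
    ((zc ≤ fcd × fcd ≤ zc + γc) × (γc ≤ fcd × fcd ≤ zc + γc))
mainTheorem1 G _ zc fcd γc minZ minF minD = (Zc≤Fcd , upper) , (γc≤Fcd , upper)
  where
  Zc≤Fcd : zc ≤ fcd
  Zc≤Fcd = IsMinSize-mono (λ { (connected , _ , forcing) → connected , forcing }) minZ minF

  γc≤Fcd : γc ≤ fcd
  γc≤Fcd = IsMinSize-mono (λ { (connected , dominating , _) → connected , dominating }) minD minF

  upper : fcd ≤ zc + γc
  upper = Fcd≤Zc+γc G minZ minF minD
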